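{- Let $\mathcal{L}_1=(S_1,\iota_1,\rightarrow_1)$ and $\mathcal{L}_2=(S_2,\iota_2,\rightarrow_2)$ be finite-state, finitely branching LTSs. Then the procedure $\textsc{Refines}_{\mathsf{fdr}}(\mathcal{L}_1,\mathcal{L}_2)$ terminates.
   Context: Fix a finite set $\mathit{Act}$ of actions not containing the internal action $\tau$; $\mathit{Act}_\tau=\mathit{Act}\cup\{\tau\}$. An LTS is $(S,\iota,\rightarrow)$ with $\iota\in S$ and $\rightarrow\subseteq S\times\mathit{Act}_\tau\times S$; $\mathsf{enabled}(s)=\{a\in\mathit{Act}_\tau\mid\exists t: s\xrightarrow{a}t\}$. The weak transition relation $\overset{\rho}{\Longrightarrow}$ ($\rho\in\mathit{Act}^*$) relates $s$ to $t$ iff there is a path from $s$ to $t$ whose labels, after deleting all $\tau$'s, form $\rho$. A state $s$ is stable if $\tau\notin\mathsf{enabled}(s)$; for stable $s$, $\mathsf{refusals}(s)=\mathcal{P}(\mathit{Act}\setminus\mathsf{enabled}(s))$; for a set $U$, $\mathsf{refusals}(U)=\{X\subseteq\mathit{Act}\mid\exists s\in U: s\text{ stable}\wedge X\in\mathsf{refusals}(s)\}$. A state diverges if it has an infinite sequence of $\tau$-transitions starting from it; a set diverges if one of its states does. On pairs $(U,s)\in\mathcal{P}(S_1)\times S_2$: $(U,s)\leq(V,t)$ iff $s=t$ and $U\subseteq V$; for a set $\mathcal{A}$ of pairs, $x\Subset\mathcal{A}$ iff some $y\in\mathcal{A}$ has $y\leq x$; $\mathcal{A}\Cup x=\{z\mid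 z=x\vee(z\in\mathcal{A}\wedge x\not\leq z)\}$. The procedure $\textsc{Refines}_{\mathsf{fdr}}$: let $I=(\{s\in S_1\mid\iota_1\overset{\epsilon}{\Longrightarrow}_1s\},\iota_2)$; initialise a stack $\mathit{working}$ containing only $I$ and $\mathit{antichain}:=\{I\}$. While $\mathit{working}$ is nonempty: pop $(\mathit{spec},\mathit{impl})$; if $\mathit{spec}$ does not diverge then: if $\mathit{impl}$ diverges return false; if $\mathit{impl}$ is stable and $\mathsf{refusals}(\mathit{impl})\not\subseteq\mathsf{refusals}(\mathit{spec})$ return false; for each transition $\mathit{impl}\xrightarrow{a}_2\mathit{impl}'$: let $\mathit{spec}'=\mathit{spec}$ if $a=\tau$, else $\mathit{spec}'=\{s'\mid\exists s\in\mathit{spec}: s\overset{a}{\Longrightarrow}_1s'\}$; if $\mathit{spec}'=\emptyset$ return false; if $(\mathit{spec}',\mathit{impl}')\not\Subset\mathit{antichain}$, set $\mathit{antichain}:=\mathit{antichain}\Cup(\mathit{spec}',\mathit{impl}')$ and push $(\mathit{spec}',\mathit{impl}')$ onto $\mathit{working}$. When $\mathit{working}$ is empty, return true. -}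

module Defs where

open import Data.Nat using (ℕ; suc)
open import Data.Bool using (Bool; true; false)
open import Data.Fin using (Fin) renaming (_≟_ to _≟ᶠ_)
open import Data.Fin.Subset using (Subset; _∈_; _⊆_; Empty)
open import Data.Fin.Subset.Properties using (_⊆?_)
open import Data.List using (List; []; _∷_; filter)
open import Data.List.Relation.Unary.Unique.Propositional using (Unique)
import Data.List.Membership.Propositional as LM
open import Data.Product using (Σ; ∃; _×_; _,_)
open import Relation.Binary.PropositionalEquality using (_≡_)
open import Relation.Nullary using (¬_; Dec; yes; no)
open import Relation.Nullary.Decidable using (_×-dec_; ¬?)
open import Function.Bundles using (_⇔_)

-- Act = Fin k ;  Act_τ = ActT k, with τ the internal action
data ActT (k : ℕ) : Set where
  τ   : ActT k
  act : Fin k → ActT k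

-- Finite branching is automatic (finitely many states and actions).
record LTS (k : ℕ) : Set where
  field
    n  : ℕ
    ι  : Fin n
    tr : Fin n → ActT k → Fin n → Bool

module _ {k : ℕ} (L : LTS k) where
  open LTS L

  data Weak : Fin n → List (Fin k) → Fin n → Set where
    wrefl : ∀ {s} → Weak s [] s
    wτ    : ∀ {s t u ρ} → tr s τ t ≡ true → Weak t ρ u → Weak s ρ u
    wact  : ∀ {s t u a ρ} → tr s (act a) t ≡ true → Weak t ρ u → Weak s (a ∷ ρ) u

  Stable : Fin n → Set
  Stable s = ∀ t → tr s τ t ≡ false

  RefusalOf : Fin n → Subset k → Set
  RefusalOf s X = Stable s × (∀ a → a ∈ X → ∀ t → tr s (act a) t ≡ false)

  RefusalOfSet : Subset n → Subset k → Set
  RefusalOfSet U X = ∃ λ s → s ∈ U × RefusalOf s X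

  Diverges : Fin n → Set
  Diverges s = Σ (ℕ → Fin n) λ f → f 0 ≡ s × (∀ i → tr (f i) τ (f (suc i)) ≡ true)

  DivergesSet : Subset n → Set
  DivergesSet U = ∃ λ s → s ∈ U × Diverges s

-- The procedure Refines_fdr(L₁, L₂) as a small-step (nondeterministic only in the
-- order in which the transitions of impl are processed) transition system.
module RefinesFDR {k : ℕ} (L₁ L₂ : LTS k) where
  open LTS L₁ renaming (n to n₁; ι to ι₁; tr to tr₁)
  open LTS L₂ renaming (n to n₂; ι to ι₂; tr to tr₂)

  Pair : Set
  Pair = Subset n₁ × Fin n₂

  _≤ₚ_ : Pair → Pair → Set
  (U , s) ≤ₚ (V , t) = s ≡ t × U ⊆ V

  _≤ₚ?_ : (x y : Pair) → Dec (x ≤ₚ y)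
  (U , s) ≤ₚ? (V , t) = (s ≟ᶠ t) ×-dec (U ⊆? V)

  _⋐_ : Pair → List Pair → Set
  x ⋐ A = ∃ λ y → y LM.∈ A × y ≤ₚ x

  _⋓_ : List Pair → Pair → List Pair
  A ⋓ x = x ∷ filter (λ z → ¬? (x ≤ₚ? z)) A

  Post : Subset n₁ → ActT k → Subset n₁ → Set
  Post spec τ       spec' = spec' ≡ spec
  Post spec (act a) spec' =
    ∀ s' → (s' ∈ spec') ⇔ (∃ λ s → s ∈ spec × Weak L₁ s (a ∷ []) s')

  data Config : Set where
    start : Config
    ret   : Bool → Config
    loop  : (working : List Pair) → (antichain : List Pair) → Config
    -- inside the "for each transition" loop for the popped (spec , impl);
    -- todo = the transitions impl --a--> impl' still to be processed
    inner : (spec : Subset n₁) → (todo : List (ActT k × Fin n₂))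
          → (working : List Pair) → (antichain : List Pair) → Config

  data Step : Config → Config → Set where
    init    : ∀ U → (∀ s → (s ∈ U) ⇔ Weak L₁ ι₁ [] s) →
              Step start (loop ((U , ι₂) ∷ []) ((U , ι₂) ∷ []))
    done    : ∀ A → Step (loop [] A) (ret true)
    popDiv  : ∀ spec impl w A → DivergesSet L₁ spec →
              Step (loop ((spec , impl) ∷ w) A) (loop w A)
    implDiv : ∀ spec impl w A → ¬ DivergesSet L₁ spec → Diverges L₂ impl →
              Step (loop ((spec , impl) ∷ w) A) (ret false)
    refFail : ∀ spec impl w A → ¬ DivergesSet L₁ spec → ¬ Diverges L₂ impl →
              Stable L₂ impl →
              ¬ (∀ X → RefusalOf L₂ impl X → RefusalOfSet L₁ spec X) →
              Step (loop ((spec , impl) ∷ w) A) (ret false)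
    expand  : ∀ spec impl w A (ts : List (ActT k × Fin n₂)) →
              ¬ DivergesSet L₁ spec → ¬ Diverges L₂ impl →
              (Stable L₂ impl → ∀ X → RefusalOf L₂ impl X → RefusalOfSet L₁ spec X) →
              (∀ a t → ((a , t) LM.∈ ts) ⇔ (tr₂ impl a t ≡ true)) → Unique ts →
              Step (loop ((spec , impl) ∷ w) A) (inner spec ts w A)
    innerEnd : ∀ spec w A → Step (inner spec [] w A) (loop w A)
    emptyFail : ∀ spec a t ts w A spec' → Post spec a spec' → Empty spec' →
              Step (inner spec ((a , t) ∷ ts) w A) (ret false)
    skip    : ∀ spec a t ts w A spec' → Post spec a spec' → ¬ Empty spec' →
              (spec' , t) ⋐ A →
              Step (inner spec ((a , t) ∷ ts) w A) (inner spec ts w A)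
    push    : ∀ spec a t ts w A spec' → Post spec a spec' → ¬ Empty spec' →
              ¬ ((spec' , t) ⋐ A) →
              Step (inner spec ((a , t) ∷ ts) w A)
                   (inner spec ts ((spec' , t) ∷ w) (A ⋓ (spec' , t)))

  _⟵_ : Config → Config → Set
  c' ⟵ c = Step c c'

-- The loop of Refines_fdr either pops the working stack or walks through the
-- finite list of transitions of the popped implementation state; the only step
-- that makes the working stack grow is a push, and a push happens only when the
-- new pair (spec' , impl') is not yet covered by the antichain (¬ x ⋐ A).  After
-- the push every pair covered before is still covered (covering is preserved by
-- _⋓_) and the new pair is covered as well.  Since there are only finitely many
-- pairs (subsets of S₁ times states of S₂), the number of UNCOVERED pairs is a
-- natural number that strictly decreases with every push.
module Submission where

open import Defs
open import Induction.WellFounded using (Acc; acc)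
open import Data.Nat using (ℕ; zero; suc; _<_)
open import Data.Nat.Properties using (≤∧≢⇒<)
open import Data.Nat.Induction using (<-wellFounded)
open import Data.Bool using (Bool; true; false)
open import Data.Vec using (Vec; []; _∷_)
open import Data.List using (List; []; _∷_; map; _++_; filter; length; cartesianProduct; allFin)
open import Data.List.Relation.Unary.Any using (here; there)
open import Data.List.Membership.Propositional using (_∈_)
open import Data.List.Membership.Propositional.Properties
  using (∈-filter⁺; ∈-filter⁻; ∈-map⁺; ∈-++⁺ˡ; ∈-++⁺ʳ; ∈-cartesianProduct⁺; ∈-allFin)
open import Data.List.Relation.Binary.Sublist.Propositional using (⊆-refl) renaming (_⊆_ to _⊑_)
open import Data.List.Relation.Binary.Sublist.Propositional.Properties using (filter⁺; length-mono-≤; to-≋)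
open import Data.List.Relation.Binary.Equality.Propositional using (≋⇒≡)
open import Data.Product using (_,_; proj₂)
open import Relation.Binary.PropositionalEquality using (_≢_; refl; sym; subst)
open import Relation.Nullary using (¬_; Dec; yes; no)
open import Relation.Nullary.Decidable using (¬?)
open import Relation.Unary using (Decidable)

subsets : ∀ n → List (Vec Bool n)
subsets zero    = [] ∷ []
subsets (suc n) = map (true ∷_) (subsets n) ++ map (false ∷_) (subsets n)

∈-subsets : ∀ {n} (U : Vec Bool n) → U ∈ subsets n
∈-subsets []          = here refl
∈-subsets (true ∷ U)  = ∈-++⁺ˡ (∈-map⁺ (true ∷_) (∈-subsets U))
∈-subsets (false ∷ U) = ∈-++⁺ʳ (map (true ∷_) (subsets _)) (∈-map⁺ (false ∷_) (∈-subsets U))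

-- Strengthening a decidable predicate from P to Q ⊆ P strictly shortens its
-- filter on a list, as soon as the list contains a witness of P that fails Q.
-- (filter Q is a sublist of filter P; equal length would make them equal.)
filter-length-< : ∀ {A : Set} {P Q : A → Set} (P? : Decidable P) (Q? : Decidable Q) →
                  (∀ {z} → Q z → P z) → ∀ {x} xs → x ∈ xs → P x → ¬ Q x →
                  length (filter Q? xs) < length (filter P? xs)
filter-length-< P? Q? Q⇒P {x} xs x∈xs px ¬qx =
  ≤∧≢⇒< (length-mono-≤ sublist) lengths-differ
  where
  sublist : filter Q? xs ⊑ filter P? xs
  sublist = filter⁺ Q? P? (λ { refl → Q⇒P }) (⊆-refl {x = xs})

  lengths-differ : length (filter Q? xs) ≢ length (filter P? xs)
  lengths-differ eq = ¬qx (proj₂ (∈-filter⁻ Q? {xs = xs} x∈filterQ))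
    where
    x∈filterQ : x ∈ filter Q? xs
    x∈filterQ = subst (x ∈_) (sym (≋⇒≡ (to-≋ eq sublist))) (∈-filter⁺ P? x∈xs px)

module Termination {k : ℕ} (L₁ L₂ : LTS k) where
  open LTS L₁ using () renaming (n to n₁)
  open LTS L₂ using () renaming (n to n₂)
  open RefinesFDR L₁ L₂

  pairs : List Pair
  pairs = cartesianProduct (subsets n₁) (allFin n₂)

  ∈-pairs : ∀ x → x ∈ pairs
  ∈-pairs (U , s) = ∈-cartesianProduct⁺ (∈-subsets U) (∈-allFin s)

  -- ≤ₚ is a preorder: reflexivity makes a freshly inserted pair covered,
  -- transitivity lets coverage survive the pruning done by ⋓.
  ≤ₚ-refl : ∀ {x} → x ≤ₚ x
  ≤ₚ-refl = refl , λ m → m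

  ≤ₚ-trans : ∀ {x y z} → x ≤ₚ y → y ≤ₚ z → x ≤ₚ z
  ≤ₚ-trans (refl , U⊆V) (refl , V⊆W) = refl , λ m → V⊆W (U⊆V m)

  ⋐? : ∀ x A → Dec (x ⋐ A)
  ⋐? x [] = no λ { (_ , () , _) }
  ⋐? x (y ∷ A) with y ≤ₚ? x | ⋐? x A
  ... | yes y≤x | _                   = yes (y , here refl , y≤x)
  ... | no _    | yes (z , z∈A , z≤x) = yes (z , there z∈A , z≤x)
  ... | no y≰x  | no x⋐̸A             = no λ
    { (_ , here refl , y≤x) → y≰x y≤x
    ; (z , there z∈A , z≤x) → x⋐̸A (z , z∈A , z≤x) }

  -- Inserting x into an antichain keeps every covered pair covered: an element
  -- dropped by A ⋓ x lies above x, so x itself covers what it covered.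
  ⋐-⋓ : ∀ {z} A x → z ⋐ A → z ⋐ (A ⋓ x)
  ⋐-⋓ A x (y , y∈A , y≤z) with x ≤ₚ? y
  ... | yes x≤y = x , here refl , ≤ₚ-trans x≤y y≤z
  ... | no x≰y  = y , there (∈-filter⁺ (λ w → ¬? (x ≤ₚ? w)) y∈A x≰y) , y≤z

  uncovered : List Pair → ℕ
  uncovered A = length (filter (λ z → ¬? (⋐? z A)) pairs)

  uncovered-push : ∀ A x → ¬ (x ⋐ A) → uncovered (A ⋓ x) < uncovered A
  uncovered-push A x x⋐̸A =
    filter-length-< (λ z → ¬? (⋐? z A)) (λ z → ¬? (⋐? z (A ⋓ x)))
      (λ z⋐̸A⋓x z⋐A → z⋐̸A⋓x (⋐-⋓ A x z⋐A))
      pairs (∈-pairs x) x⋐̸A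
      (λ x⋐̸A⋓x → x⋐̸A⋓x (x , here refl , ≤ₚ-refl))

  halted : ∀ b → Acc _⟵_ (ret b)
  halted b = acc λ ()

  -- Every successor of a main-loop or inner-loop configuration is accessible,
  -- by well-founded induction on the measure of the antichain, then
  -- structurally on the working stack (main loop) and on the transitions still
  -- to be processed (inner loop).  Only a push enlarges the working stack, and
  -- it decreases the measure.
  mutual
    loop-succ : ∀ {A} → Acc _<_ (uncovered A) → ∀ w {c} → Step (loop w A) c → Acc _⟵_ c
    loop-succ rec []      (done _)                      = halted true
    loop-succ rec (_ ∷ w) (popDiv _ _ _ _ _)            = acc (loop-succ rec w)
    loop-succ rec (_ ∷ w) (implDiv _ _ _ _ _ _)         = halted false
    loop-succ rec (_ ∷ w) (refFail _ _ _ _ _ _ _ _)     = halted false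
    loop-succ rec (_ ∷ w) (expand _ _ _ _ ts _ _ _ _ _) = acc (inner-succ rec w ts)

    inner-succ : ∀ {A spec} → Acc _<_ (uncovered A) → ∀ w ts {c} →
                 Step (inner spec ts w A) c → Acc _⟵_ c
    inner-succ rec w []       (innerEnd _ _ _)               = acc (loop-succ rec w)
    inner-succ rec w (_ ∷ ts) (emptyFail _ _ _ _ _ _ _ _ _)  = halted false
    inner-succ rec w (_ ∷ ts) (skip _ _ _ _ _ _ _ _ _ _)     = acc (inner-succ rec w ts)
    inner-succ {A} (acc smaller) w ((_ , t) ∷ ts) (push _ _ _ _ _ _ spec' _ _ x⋐̸A) =
      acc (inner-succ (smaller (uncovered-push A (spec' , t) x⋐̸A)) ((spec' , t) ∷ w) ts)

  start-acc : Acc _⟵_ start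
  start-acc = acc λ { (init U _) → acc (loop-succ (<-wellFounded _) ((U , _) ∷ [])) }

theorem5p6 : ∀ {k} (L₁ L₂ : LTS k) → Acc (RefinesFDR._⟵_ L₁ L₂) (RefinesFDR.start {L₁ = L₁} {L₂ = L₂})
theorem5p6 L₁ L₂ = Termination.start-acc L₁ L₂
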